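{- Let $T$ be the tournament on vertex set $\{c,v_0,v_1,v_2,v_3,v_4\}$ with edges $v_i\to v_{i+1}$ and $v_i\to v_{i+3}$ for each $i$ (indices modulo $5$) and $c\to v_i$ for all $i$, and let $g=g_T$. Then $g$ is special and $\operatorname{Aut}(g)$ has order $5$.
   Context: For a tournament $T$, $e_T(x,y)=1$ if $(x,y)$ is an edge and $-1$ otherwise, and $g_T(x,y,z)=e_T(x,y)e_T(y,z)e_T(z,x)$, which is an oriented two-graph: an alternating $\{\pm1\}$-valued function on ordered triples of distinct vertices satisfying $g(x,y,z)g(y,x,w)g(z,y,w)g(x,z,w)=1$ for distinct $x,y,z,w$. $\operatorname{Aut}(g)$ is the group of permutations $\sigma$ of the vertex set with $g(\sigma x,\sigma y,\sigma z)=g(x,y,z)$. An oriented two-graph $g$ on $r$ vertices is special if for every oriented two-graph $h$ on a set $W$ with $|W|=r+1$, the number of subsets $A\subset W$ with $h|_A\cong g$ (restriction to triples from $A$; isomorphism via a bijection preserving the function) is at most $2$. -}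

module Defs where

open import Data.Nat using (ℕ; suc; _+_; _∸_; _≡ᵇ_; _≤_)
open import Data.Nat.DivMod using (_%_)
open import Data.Bool using (Bool; true; false; _∨_; if_then_else_)
open import Data.Fin using (Fin; zero; suc; toℕ)
open import Data.Fin.Subset using (Subset; _∈_)
open import Data.Sign using (Sign; opposite; _*_) renaming (+ to s+; - to s-)
open import Data.Vec using (Vec; lookup)
open import Data.List using (List; length)
open import Data.List.Relation.Unary.All using (All)
open import Data.List.Relation.Unary.Unique.Propositional using (Unique)
import Data.List.Membership.Propositional as LMem
open import Data.Product using (Σ; ∃; _×_)
open import Function.Definitions using (Injective)
open import Relation.Binary.PropositionalEquality using (_≡_; _≢_)

Distinct3 : ∀ {n} → Fin n → Fin n → Fin n → Set
Distinct3 x y z = x ≢ y × y ≢ z × x ≢ z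

-- A {±1}-valued function on triples of a vertex set Fin n
-- (only its values on triples of distinct vertices matter).
Triple : ℕ → Set
Triple n = Fin n → Fin n → Fin n → Sign

Alternating : ∀ {n} → Triple n → Set
Alternating {n} g = ∀ (x y z : Fin n) → Distinct3 x y z →
  (g y x z ≡ opposite (g x y z)) × (g x z y ≡ opposite (g x y z))

Cocycle : ∀ {n} → Triple n → Set
Cocycle {n} g = ∀ (x y z w : Fin n) → Distinct3 x y z →
  x ≢ w → y ≢ w → z ≢ w →
  g x y z * g y x w * g z y w * g x z w ≡ s+

IsOrientedTwoGraph : ∀ {n} → Triple n → Set
IsOrientedTwoGraph g = Alternating g × Cocycle g

-- e_T and g_T for a tournament given by its edge relation (true = edge x → y).
eT : ∀ {n} → (Fin n → Fin n → Bool) → Fin n → Fin n → Sign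
eT E x y = if E x y then s+ else s-

gT : ∀ {n} → (Fin n → Fin n → Bool) → Triple n
gT E x y z = eT E x y * eT E y z * eT E z x

RestrictIso : ∀ {r} → Triple (suc r) → Triple r → Subset (suc r) → Set
RestrictIso {r} h g A =
  Σ (Fin r → Fin (suc r)) λ f →
    Injective _≡_ _≡_ f ×
    (∀ j → (j ∈ A → ∃ λ i → f i ≡ j) × ((∃ λ i → f i ≡ j) → j ∈ A)) ×
    (∀ x y z → Distinct3 x y z → h (f x) (f y) (f z) ≡ g x y z)

Special : ∀ {r} → Triple r → Set
Special {r} g = ∀ (h : Triple (suc r)) → IsOrientedTwoGraph h →
  ∀ (L : List (Subset (suc r))) → Unique L → All (RestrictIso h g) L → length L ≤ 2

IsAut : ∀ {n} → Triple n → (Fin n → Fin n) → Set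
IsAut {n} g σ = Injective _≡_ _≡_ σ ×
  (∀ (x y z : Fin n) → Distinct3 x y z → g (σ x) (σ y) (σ z) ≡ g x y z)

-- Aut(g) has exactly k elements; permutations are encoded by their value tables
-- v : Vec (Fin n) n, i.e. σ = lookup v.
AutOrder : ∀ {n} → Triple n → ℕ → Set
AutOrder {n} g k = Σ (List (Vec (Fin n) n)) λ L →
  Unique L × length L ≡ k ×
  (∀ v → (IsAut g (lookup v) → v LMem.∈ L) × (v LMem.∈ L → IsAut g (lookup v)))

-- The tournament T: vertex 0 = c, vertex (suc i) = v_i (i ∈ Fin 5).
-- c → v_i; v_i → v_j iff j - i ≡ 1 or 3 (mod 5).
T : Fin 6 → Fin 6 → Bool
T zero zero = false
T zero (suc j) = true
T (suc i) zero = false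
T (suc i) (suc j) = let d = (toℕ j + 5 ∸ toℕ i) % 5 in (d ≡ᵇ 1) ∨ (d ≡ᵇ 3)

g : Triple 6
g = gT T

-- A copy of g in an oriented two-graph h on seven vertices can be relabelled onto the old
-- vertices of a one-vertex extension.  By the cocycle condition an oriented two-graph is determined
-- by its values on the triples through one vertex, here c, so h is then g of a tournament extending
-- T; switching at the new vertex fixes its edge to c, which leaves 32 tournaments.  For each of them
-- an exhaustive enumeration of the embeddings of g shows that, besides the new vertex, at most one
-- further vertex is ever missed, so copies of g occupy at most two 6-sets.  The same enumeration,
-- run on g itself, finds the automorphisms: the five rotations of v₀,…,v₄.
module Submission where

open import Defs
open import Data.Bool using (Bool; true; false; not; if_then_else_)
open import Data.Bool.Properties using (not-involutive) renaming (_≟_ to _≟ᵇ_)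
open import Data.Empty using (⊥-elim)
open import Data.Fin using (Fin; zero; suc; punchOut)
open import Data.Fin.Properties
  using (_≟_; all?; any?; ¬∀⟶∃¬; suc-injective; 0≢1+n; punchOut-injective; <⇒notInjective)
open import Data.Fin.Subset using (Subset; _∈_; _⊆_; ∁; ⁅_⁆; inside)
open import Data.Fin.Subset.Properties
  using (⊆-antisym; x∈⁅x⁆; x∈⁅y⁆⇒x≡y; x∈∁p⇒x∉p; x∉p⇒x∈∁p; anySubset?)
open import Data.List using (List; []; _∷_; concatMap; map; filter; allFin)
open import Data.List.Membership.Propositional using () renaming (_∈_ to _∈ₗ_)
open import Data.List.Membership.Propositional.Properties
  using (∈-concatMap⁺; ∈-map⁺; ∈-filter⁺; ∈-allFin)
open import Data.List.Relation.Unary.All using (All; []; _∷_)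
open import Data.List.Relation.Unary.AllPairs using ([]; _∷_)
import Data.List.Relation.Unary.All as All
import Data.List.Relation.Unary.Any as Any
open import Data.Nat using (ℕ; zero; suc; z≤n; s≤s)
open import Data.Nat.Properties using (n<1+n)
open import Data.Product using (Σ; ∃; _×_; _,_; proj₁; proj₂)
open import Data.Sign using (Sign; opposite; _*_) renaming (+ to s+; - to s-)
open import Data.Sign.Properties
  using (*-assoc; *-comm; *-cancelʳ-≡; s*s≡+; opposite[s]*s≡-; opposite-involutive;
         *-commutativeMonoid)
  renaming (_≟_ to _≟ˢ_)
open import Algebra.Solver.CommutativeMonoid *-commutativeMonoid using (solve; _⊜_; _⊕_)
open import Data.Vec using (Vec; []; _∷_; lookup; tabulate)
open import Data.Vec.Functional using () renaming (_∷_ to _∷ᶠ_)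
open import Data.Vec.Membership.Propositional using () renaming (_∈_ to _∈ᵥ_; _∉_ to _∉ᵥ_)
import Data.Vec.Membership.DecPropositional as VecMembership
open import Data.Vec.Properties using (lookup∘tabulate; tabulate∘lookup; ≡-dec)
open import Data.List.Relation.Unary.Unique.DecPropositional (≡-dec {n = 6} (_≟_ {6})) using (unique?)
open import Data.Vec.Relation.Unary.Any.Properties using (tabulate⁻)
open import Function using (_∘_)
open import Function.Definitions using (Injective)
open import Relation.Binary.PropositionalEquality
open import Relation.Nullary using (Dec; yes; no; does; ¬_; ¬?; _×-dec_; _→-dec_; contradiction)
open import Relation.Nullary.Decidable using (map′; decidable-stable)

private
  variable
    n : ℕ

-- Computations are stated as does a? ≡ true and checked by refl, which is much faster than
-- solving True a? by instance search.
decided : ∀ {A : Set} (a? : Dec A) → does a? ≡ true → A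
decided (yes a) _ = a

refuted : ∀ {A : Set} (a? : Dec A) → does a? ≡ false → ¬ A
refuted (no ¬a) _ = ¬a

*≡-⇒≡opposite : ∀ {s t} → s * t ≡ s- → s ≡ opposite t
*≡-⇒≡opposite {s} {t} st≡- = *-cancelʳ-≡ t s (opposite t) (trans st≡- (sym (opposite[s]*s≡- t)))

*≡+⇒≡ : ∀ {s t} → s * t ≡ s+ → s ≡ t
*≡+⇒≡ {s} {t} st≡+ = *-cancelʳ-≡ t s t (trans st≡+ (sym (s*s≡+ t)))

regroup₃ : ∀ a a′ b b′ c c′ → (a′ * c′ * b′) * (a * b * c) ≡ (a * a′) * (b * b′) * (c * c′)
regroup₃ = solve 6 (λ a a′ b b′ c c′ →
  ((a′ ⊕ c′) ⊕ b′) ⊕ ((a ⊕ b) ⊕ c) ⊜ ((a ⊕ a′) ⊕ (b ⊕ b′)) ⊕ (c ⊕ c′)) refl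

regroup₆ : ∀ a a′ b b′ c c′ d d′ e e′ f f′ →
  (a * b * c) * (a′ * d * e′) * (b′ * e * f′) * (c′ * f * d′) ≡
  (a * a′) * (b * b′) * (c * c′) * (d * d′) * (e * e′) * (f * f′)
regroup₆ = solve 12 (λ a a′ b b′ c c′ d d′ e e′ f f′ →
  ((((a ⊕ b) ⊕ c) ⊕ ((a′ ⊕ d) ⊕ e′)) ⊕ ((b′ ⊕ e) ⊕ f′)) ⊕ ((c′ ⊕ f) ⊕ d′) ⊜
  (((((a ⊕ a′) ⊕ (b ⊕ b′)) ⊕ (c ⊕ c′)) ⊕ (d ⊕ d′)) ⊕ (e ⊕ e′)) ⊕ (f ⊕ f′)) refl

Distinct3-map : ∀ {m} {f : Fin n → Fin m} → Injective _≡_ _≡_ f →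
                ∀ {x y z} → Distinct3 x y z → Distinct3 (f x) (f y) (f z)
Distinct3-map inj (x≢y , y≢z , x≢z) = x≢y ∘ inj , y≢z ∘ inj , x≢z ∘ inj

Distinct3-suc⁻ : ∀ {x y z : Fin n} → Distinct3 (suc x) (suc y) (suc z) → Distinct3 x y z
Distinct3-suc⁻ (x≢y , y≢z , x≢z) = x≢y ∘ cong suc , y≢z ∘ cong suc , x≢z ∘ cong suc

Distinct3-swap : ∀ {x y z : Fin n} → Distinct3 x y z → Distinct3 y x z
Distinct3-swap (x≢y , y≢z , x≢z) = ≢-sym x≢y , x≢z , y≢z

Distinct3-rotate : ∀ {x y z : Fin n} → Distinct3 x y z → Distinct3 y z x
Distinct3-rotate (x≢y , y≢z , x≢z) = y≢z , ≢-sym x≢z , ≢-sym x≢y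

IsTournament : (Fin n → Fin n → Bool) → Set
IsTournament {n} E = ∀ {x y : Fin n} → x ≢ y → E y x ≡ not (E x y)

module _ {E : Fin n → Fin n → Bool} (tournament : IsTournament E) where

  eT-antisym : ∀ {x y} → x ≢ y → eT E x y * eT E y x ≡ s-
  eT-antisym {x} {y} x≢y rewrite tournament x≢y with E x y
  ... | true = refl
  ... | false = refl

  gT-rotate : ∀ x y z → gT E x y z ≡ gT E y z x
  gT-rotate x y z = trans (*-assoc (eT E x y) _ _) (*-comm (eT E x y) _)

  gT-swap : ∀ {x y z} → Distinct3 x y z → gT E y x z ≡ opposite (gT E x y z)
  gT-swap {x} {y} {z} (x≢y , y≢z , x≢z) = *≡-⇒≡opposite (begin
    gT E y x z * gT E x y z
      ≡⟨ regroup₃ (e x y) (e y x) (e y z) (e z y) (e z x) (e x z) ⟩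
    (e x y * e y x) * (e y z * e z y) * (e z x * e x z)
      ≡⟨ cong₂ _*_ (cong₂ _*_ (eT-antisym x≢y) (eT-antisym y≢z)) (eT-antisym (≢-sym x≢z)) ⟩
    s- ∎)
    where open ≡-Reasoning
          e = eT E

  gT-isOrientedTwoGraph : IsOrientedTwoGraph (gT E)
  gT-isOrientedTwoGraph = alternating , cocycle
    where
    alternating : Alternating (gT E)
    alternating x y z d = gT-swap d , trans (sym (gT-rotate y x z)) (gT-swap d)

    -- Each of the six edges among x, y, z, w occurs once in each direction.
    cocycle : Cocycle (gT E)
    cocycle x y z w (x≢y , y≢z , x≢z) x≢w y≢w z≢w = begin
      gT E x y z * gT E y x w * gT E z y w * gT E x z w
        ≡⟨ regroup₆ (e x y) (e y x) (e y z) (e z y) (e z x) (e x z)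
                    (e x w) (e w x) (e y w) (e w y) (e z w) (e w z) ⟩
      (e x y * e y x) * (e y z * e z y) * (e z x * e x z) *
        (e x w * e w x) * (e y w * e w y) * (e z w * e w z)
        ≡⟨ cong₂ _*_ (cong₂ _*_ (cong₂ _*_ (cong₂ _*_ (cong₂ _*_
             (eT-antisym x≢y) (eT-antisym y≢z)) (eT-antisym (≢-sym x≢z)))
             (eT-antisym x≢w)) (eT-antisym y≢w)) (eT-antisym z≢w) ⟩
      s+ ∎
      where open ≡-Reasoning
            e = eT E

pullback : ∀ {m} → Triple m → (Fin n → Fin m) → Triple n
pullback h σ x y z = h (σ x) (σ y) (σ z)

pullback-isOrientedTwoGraph : ∀ {m} {h : Triple m} {σ : Fin n → Fin m} →
  Injective _≡_ _≡_ σ → IsOrientedTwoGraph h → IsOrientedTwoGraph (pullback h σ)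
pullback-isOrientedTwoGraph {σ = σ} inj (alt , coc) =
  (λ x y z d → alt (σ x) (σ y) (σ z) (Distinct3-map inj d)) ,
  (λ x y z w d x≢w y≢w z≢w →
     coc (σ x) (σ y) (σ z) (σ w) (Distinct3-map inj d) (x≢w ∘ inj) (y≢w ∘ inj) (z≢w ∘ inj))

alternating-rotate : {h : Triple n} → Alternating h →
                     ∀ {x y z} → Distinct3 x y z → h x y z ≡ h y z x
alternating-rotate {h = h} alt {x} {y} {z} d = sym (begin
  h y z x              ≡⟨ proj₂ (alt y x z (Distinct3-swap d)) ⟩
  opposite (h y x z)   ≡⟨ cong opposite (proj₁ (alt x y z d)) ⟩
  opposite (opposite (h x y z)) ≡⟨ opposite-involutive _ ⟩
  h x y z              ∎)
  where open ≡-Reasoning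

cocycle-solve : {h : Triple n} → Cocycle h → ∀ {x y z w} → Distinct3 x y z →
                x ≢ w → y ≢ w → z ≢ w → h x y z ≡ h y x w * h z y w * h x z w
cocycle-solve {h = h} coc {x} {y} {z} {w} d x≢w y≢w z≢w = *≡+⇒≡ (begin
  h x y z * (h y x w * h z y w * h x z w)
    ≡⟨ sym (trans (cong (_* h x z w) (*-assoc (h x y z) _ _)) (*-assoc (h x y z) _ _)) ⟩
  h x y z * h y x w * h z y w * h x z w
    ≡⟨ coc x y z w d x≢w y≢w z≢w ⟩
  s+ ∎)
  where open ≡-Reasoning

_≋_ : Triple n → Triple n → Set
h ≋ h′ = ∀ x y z → Distinct3 x y z → h x y z ≡ h′ x y z

-- Through the cocycle condition with fourth vertex a, every value is a product of values at
-- triples containing a.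
≋-through : {h h′ : Triple n} → IsOrientedTwoGraph h → IsOrientedTwoGraph h′ → (a : Fin n) →
            (∀ x y → Distinct3 x y a → h x y a ≡ h′ x y a) → h ≋ h′
≋-through {h = h} {h′} (alt , coc) (alt′ , coc′) a agree x y z d@(x≢y , y≢z , x≢z)
  with z ≟ a | x ≟ a | y ≟ a
... | yes refl | _ | _ = agree x y d
... | no _ | yes refl | _ =
  trans (alternating-rotate alt d)
    (trans (agree y z (Distinct3-rotate d)) (sym (alternating-rotate alt′ d)))
... | no _ | no _ | yes refl =
  trans (rotate² alt)
    (trans (agree z x (Distinct3-rotate (Distinct3-rotate d))) (sym (rotate² alt′)))
  where
  rotate² : {k : Triple _} → Alternating k → k x y z ≡ k z x y
  rotate² alt = trans (alternating-rotate alt d) (alternating-rotate alt (Distinct3-rotate d))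
... | no z≢a | no x≢a | no y≢a = begin
  h x y z                         ≡⟨ cocycle-solve {h = h} coc d x≢a y≢a z≢a ⟩
  h y x a * h z y a * h x z a     ≡⟨ cong₂ _*_ (cong₂ _*_ (agree y x (≢-sym x≢y , x≢a , y≢a))
                                                          (agree z y (≢-sym y≢z , y≢a , z≢a)))
                                               (agree x z (x≢z , z≢a , x≢a)) ⟩
  h′ y x a * h′ z y a * h′ x z a  ≡⟨ sym (cocycle-solve {h = h′} coc′ d x≢a y≢a z≢a) ⟩
  h′ x y z                        ∎
  where open ≡-Reasoning

extend : (Fin n → Fin n → Bool) → Subset n → Fin (suc n) → Fin (suc n) → Bool
extend E D zero    zero    = false
extend E D zero    (suc j) = lookup D j
extend E D (suc i) zero    = not (lookup D i)
extend E D (suc i) (suc j) = E i j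

extend-isTournament : ∀ {E : Fin n → Fin n → Bool} {D} → IsTournament E → IsTournament (extend E D)
extend-isTournament _ {zero}  {zero}  x≢y = contradiction refl x≢y
extend-isTournament _ {zero}  {suc j} _   = refl
extend-isTournament {D = D} _ {suc i} {zero} _ = sym (not-involutive (lookup D i))
extend-isTournament tournament {suc i} {suc j} x≢y = tournament (x≢y ∘ cong suc)

-- The sign of the edge from the new vertex that makes a triangle through it have sign s.
fit-edge : ∀ s t → (if does (s ≟ˢ opposite t) then s+ else s-) * t * s- ≡ s
fit-edge s+ s+ = refl
fit-edge s+ s- = refl
fit-edge s- s+ = refl
fit-edge s- s- = refl

-- Switching at the new vertex lets its edge to the old vertex zero be fixed.
≋-extend : ∀ {m} {E : Fin (suc m) → Fin (suc m) → Bool} {h : Triple (suc (suc m))} →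
           IsTournament E → IsOrientedTwoGraph h → pullback h suc ≋ gT E →
           ∃ λ b → h ≋ gT (extend E (inside ∷ b))
≋-extend {E = E} {h} tournament og@(alt , _) old = b , ≋-through og og′ c through
  where
  c = suc zero
  old-edge : Fin _ → Sign
  old-edge k = eT E (suc k) zero
  edge : Fin _ → Bool
  edge k = does (h zero (suc (suc k)) c ≟ˢ opposite (old-edge k))
  b = tabulate edge
  og′ = gT-isOrientedTwoGraph (extend-isTournament tournament)
  new : ∀ k → h zero (suc (suc k)) c ≡ gT (extend E (inside ∷ b)) zero (suc (suc k)) c
  new k rewrite lookup∘tabulate edge k = sym (fit-edge (h zero (suc (suc k)) c) (old-edge k))
  through : ∀ x y → Distinct3 x y c → h x y c ≡ gT (extend E (inside ∷ b)) x y c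
  through zero          zero          (x≢y , _)     = contradiction refl x≢y
  through zero          (suc zero)    (_ , y≢c , _) = contradiction refl y≢c
  through (suc zero)    zero          (_ , _ , x≢c) = contradiction refl x≢c
  through zero          (suc (suc k)) _             = new k
  through (suc (suc k)) zero          d             =
    trans (proj₁ (alt zero (suc (suc k)) c (Distinct3-swap d)))
      (trans (cong opposite (new k)) (sym (proj₁ (proj₁ og′ zero (suc (suc k)) c (Distinct3-swap d)))))
  through (suc i)       (suc j)       d             = old i j zero (Distinct3-suc⁻ d)

injective⇒surjective : {f : Fin n → Fin n} → Injective _≡_ _≡_ f → ∀ y → ∃ λ x → f x ≡ y
injective⇒surjective {suc n} {f} inj y with any? (λ x → f x ≟ y)
... | yes hit = hit
... | no miss = ⊥-elim (<⇒notInjective (n<1+n n) punchedInjective)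
  where
  y≢f : ∀ x → y ≢ f x
  y≢f x y≡fx = miss (x , sym y≡fx)
  punchedInjective : Injective _≡_ _≡_ (λ x → punchOut (y≢f x))
  punchedInjective e = inj (punchOut-injective (y≢f _) (y≢f _) e)

∷ᶠ-injective : ∀ {m} {f : Fin n → Fin m} {y} → Injective _≡_ _≡_ f → (∀ i → f i ≢ y) →
               Injective _≡_ _≡_ (y ∷ᶠ f)
∷ᶠ-injective _   _      {zero}  {zero}  _ = refl
∷ᶠ-injective _   misses {zero}  {suc j} e = contradiction (sym e) (misses j)
∷ᶠ-injective _   misses {suc i} {zero}  e = contradiction e (misses i)
∷ᶠ-injective inj _      {suc i} {suc j} e = cong suc (inj e)

injective⇒∃missed : {f : Fin n → Fin (suc n)} → Injective _≡_ _≡_ f → ∃ λ m → ∀ i → f i ≢ m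
injective⇒∃missed {n} {f} inj with all? (λ y → any? (λ i → f i ≟ y))
... | yes hits = ⊥-elim (<⇒notInjective (n<1+n n) preimageInjective)
  where
  preimageInjective : Injective _≡_ _≡_ (λ y → proj₁ (hits y))
  preimageInjective {y} {y′} e = trans (sym (proj₂ (hits y))) (trans (cong f e) (proj₂ (hits y′)))
... | no ¬hits with m , ¬hit ← ¬∀⟶∃¬ _ _ (λ y → any? (λ i → f i ≟ y)) ¬hits =
  m , λ i fi≡m → ¬hit (i , fi≡m)

injective⇒hitsAllBut : ∀ {f : Fin n → Fin (suc n)} {m} → Injective _≡_ _≡_ f →
                       (∀ i → f i ≢ m) → ∀ {j} → j ≢ m → ∃ λ i → f i ≡ j
injective⇒hitsAllBut inj misses {j} j≢m
  with injective⇒surjective (∷ᶠ-injective inj misses) j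
... | zero  , m≡j  = contradiction (sym m≡j) j≢m
... | suc i , fi≡j = i , fi≡j

image≡∁⁅missed⁆ : ∀ {f : Fin n → Fin (suc n)} {m A} → Injective _≡_ _≡_ f → (∀ i → f i ≢ m) →
                  (∀ j → (j ∈ A → ∃ λ i → f i ≡ j) × ((∃ λ i → f i ≡ j) → j ∈ A)) →
                  A ≡ ∁ ⁅ m ⁆
image≡∁⁅missed⁆ {m = m} inj misses image = ⊆-antisym A⊆∁ ∁⊆A
  where
  A⊆∁ : _ ⊆ ∁ ⁅ m ⁆
  A⊆∁ {j} j∈A with i , fi≡j ← proj₁ (image j) j∈A =
    x∉p⇒x∈∁p (λ j∈⁅m⁆ → misses i (trans fi≡j (x∈⁅y⁆⇒x≡y m j∈⁅m⁆)))
  ∁⊆A : ∁ ⁅ m ⁆ ⊆ _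
  ∁⊆A {j} j∈∁ = proj₂ (image j)
    (injective⇒hitsAllBut inj misses (λ { refl → x∈∁p⇒x∉p j∈∁ (x∈⁅x⁆ m) }))

IsEmbedding : ∀ {m} → Triple m → Triple n → (Fin n → Fin m) → Set
IsEmbedding {n} h g F =
  Injective _≡_ _≡_ F × (∀ (x y z : Fin n) → Distinct3 x y z → h (F x) (F y) (F z) ≡ g x y z)

distinct3? : ∀ (x y z : Fin n) → Dec (Distinct3 x y z)
distinct3? x y z = ¬? (x ≟ y) ×-dec ¬? (y ≟ z) ×-dec ¬? (x ≟ z)

isEmbedding? : ∀ {m} (h : Triple m) (g : Triple n) F → Dec (IsEmbedding h g F)
isEmbedding? h g F = injective? ×-dec
  all? λ x → all? λ y → all? λ z → distinct3? x y z →-dec (h (F x) (F y) (F z) ≟ˢ g x y z)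
  where
  injective? = map′ (λ inj {x} {y} → inj x y) (λ inj x y → inj)
                    (all? λ x → all? λ y → (F x ≟ F y) →-dec (x ≟ y))

IsEmbedding-suc : ∀ {m} {h : Triple m} {g : Triple (suc n)} {F} →
                  IsEmbedding h g F → IsEmbedding h (pullback g suc) (F ∘ suc)
IsEmbedding-suc (inj , preserves) =
  suc-injective ∘ inj , λ x y z d → preserves (suc x) (suc y) (suc z) (Distinct3-map suc-injective d)

IsEmbedding-≋ : ∀ {m} {h h′ : Triple m} {g : Triple n} {F} →
                h ≋ h′ → IsEmbedding h g F → IsEmbedding h′ g F
IsEmbedding-≋ h≋h′ (inj , preserves) =
  inj , λ x y z d → trans (sym (h≋h′ _ _ _ (Distinct3-map inj d))) (preserves x y z d)

IsEmbedding-pullback : ∀ {m} {h : Triple m} {g : Triple n} {F} {σ τ : Fin m → Fin m} →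
                       (∀ y → σ (τ y) ≡ y) → IsEmbedding h g F → IsEmbedding (pullback h σ) g (τ ∘ F)
IsEmbedding-pullback {h = h} {F = F} {σ} {τ} στ (inj , preserves) = τF-injective , τF-preserves
  where
  τF-injective : Injective _≡_ _≡_ (τ ∘ F)
  τF-injective {x} {y} e = inj (trans (sym (στ (F x))) (trans (cong σ e) (στ (F y))))
  τF-preserves : ∀ x y z → Distinct3 x y z → pullback h σ (τ (F x)) (τ (F y)) (τ (F z)) ≡ _
  τF-preserves x y z d rewrite στ (F x) | στ (F y) | στ (F z) = preserves x y z d

module Enumeration {m} (h : Triple m) where

  open VecMembership (_≟_ {m}) using (_∈?_)

  -- Necessary conditions for v to be the image of vertex zero, given the images w of the others.
  Compatible : Triple (suc n) → Vec (Fin m) n → Fin m → Set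
  Compatible g w v =
    v ∉ᵥ w × (∀ y z → y ≢ z → h v (lookup w y) (lookup w z) ≡ g zero (suc y) (suc z))

  compatible? : ∀ (g : Triple (suc n)) w v → Dec (Compatible g w v)
  compatible? g w v = ¬? (v ∈? w) ×-dec
    all? λ y → all? λ z → ¬? (y ≟ z) →-dec (h v (lookup w y) (lookup w z) ≟ˢ g zero (suc y) (suc z))

  extensions : Triple (suc n) → Vec (Fin m) n → List (Vec (Fin m) (suc n))
  extensions g w = map (_∷ w) (filter (compatible? g w) (allFin m))

  embeddings : Triple n → List (Vec (Fin m) n)
  embeddings {zero}  g = [] ∷ []
  embeddings {suc n} g = concatMap (extensions g) (embeddings (pullback g suc))

  embeddings-complete : ∀ (g : Triple n) {F} → IsEmbedding h g F → tabulate F ∈ₗ embeddings g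
  embeddings-complete {zero}  g _ = Any.here refl
  embeddings-complete {suc n} g {F} emb@(inj , preserves) =
    ∈-concatMap⁺ (extensions g)
      (Any.map (λ { refl → ∈-map⁺ (_∷ tabulate (F ∘ suc))
                             (∈-filter⁺ (compatible? g _) (∈-allFin (F zero)) compatible) })
               (embeddings-complete (pullback g suc) (IsEmbedding-suc {h = h} emb)))
    where
    compatible : Compatible g (tabulate (F ∘ suc)) (F zero)
    compatible = (λ F0∈ → let i , F0≡Fi = tabulate⁻ F0∈ in 0≢1+n (inj F0≡Fi)) ,
                 λ y z y≢z → subst₂ (λ a b → h (F zero) a b ≡ g zero (suc y) (suc z))
                   (sym (lookup∘tabulate (F ∘ suc) y)) (sym (lookup∘tabulate (F ∘ suc) z))
                   (preserves zero (suc y) (suc z) (0≢1+n , y≢z ∘ suc-injective , 0≢1+n))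

open Enumeration using (embeddings; embeddings-complete)

CoversAllBut : ∀ {m} → Fin m → Fin m → Vec (Fin m) n → Set
CoversAllBut p q w = ∀ x → x ≢ p → x ≢ q → x ∈ᵥ w

coversAllBut? : ∀ {m} (p q : Fin m) (w : Vec (Fin m) n) → Dec (CoversAllBut p q w)
coversAllBut? {m = m} p q w = all? λ x → ¬? (x ≟ p) →-dec ¬? (x ≟ q) →-dec x ∈? w
  where open VecMembership (_≟_ {m}) using (_∈?_)

CoversAllBut-missed : ∀ {m} {p q x : Fin m} {w : Vec (Fin m) n} →
                      CoversAllBut p q w → x ∉ᵥ w → x ≢ p → x ≡ q
CoversAllBut-missed {q = q} {x} covers x∉w x≢p =
  decidable-stable (x ≟ q) λ x≢q → x∉w (covers x x≢p x≢q)

record Copy (h : Triple (suc n)) (g : Triple n) : Set where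
  field
    embed       : Fin n → Fin (suc n)
    isEmbedding : IsEmbedding h g embed
    missed      : Fin (suc n)
    misses      : ∀ i → embed i ≢ missed

restrictIso⇒copy : ∀ {h : Triple (suc n)} {g A} → RestrictIso h g A →
                   Σ (Copy h g) λ c → A ≡ ∁ ⁅ Copy.missed c ⁆
restrictIso⇒copy (f , inj , image , preserves) with m , misses ← injective⇒∃missed inj =
  record { embed = f ; isEmbedding = inj , preserves ; missed = m ; misses = misses } ,
  image≡∁⁅missed⁆ inj misses image

T-isTournament : IsTournament T
T-isTournament {x} {y} =
  decided (all? λ x → all? λ y → ¬? (x ≟ y) →-dec T y x ≟ᵇ not (T x y)) refl x y

-- The extensions of T by a vertex beating c; b is the set of v_i it beats.
T⁺ : Subset 5 → Fin 7 → Fin 7 → Bool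
T⁺ b = extend T (inside ∷ b)

OneFurtherMissed : Subset 5 → Set
OneFurtherMissed b = ∃ λ q → All (CoversAllBut zero q) (embeddings (gT (T⁺ b)) g)

oneFurtherMissed : ∀ b → OneFurtherMissed b
oneFurtherMissed b =
  decidable-stable (oneFurtherMissed? b)
    λ ¬further → refuted (anySubset? (¬? ∘ oneFurtherMissed?)) refl (b , ¬further)
  where
  oneFurtherMissed? : ∀ b → Dec (OneFurtherMissed b)
  oneFurtherMissed? b = any? λ q → All.all? (coversAllBut? zero q) (embeddings (gT (T⁺ b)) g)

-- Relabel h so that the copy c₁ sits on the old vertices and its missed vertex becomes the new one.
copies-missSame : ∀ {h : Triple 7} → IsOrientedTwoGraph h → (c₁ c₂ c₃ : Copy h g) →
                  Copy.missed c₂ ≢ Copy.missed c₁ → Copy.missed c₃ ≢ Copy.missed c₁ →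
                  Copy.missed c₂ ≡ Copy.missed c₃
copies-missSame {h} og c₁ c₂ c₃ m₂≢m₁ m₃≢m₁ = begin
  missed c₂          ≡⟨ sym (στ (missed c₂)) ⟩
  σ (τ (missed c₂))  ≡⟨ cong σ (trans (relabelled c₂ m₂≢m₁) (sym (relabelled c₃ m₃≢m₁))) ⟩
  σ (τ (missed c₃))  ≡⟨ στ (missed c₃) ⟩
  missed c₃          ∎
  where
  open Copy
  open ≡-Reasoning
  σ = missed c₁ ∷ᶠ embed c₁
  σ-injective = ∷ᶠ-injective (proj₁ (isEmbedding c₁)) (misses c₁)
  τ : Fin 7 → Fin 7
  τ y = proj₁ (injective⇒surjective σ-injective y)
  στ : ∀ y → σ (τ y) ≡ y
  στ y = proj₂ (injective⇒surjective σ-injective y)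
  extension = ≋-extend T-isTournament (pullback-isOrientedTwoGraph σ-injective og)
                       (proj₂ (isEmbedding c₁))
  b = proj₁ extension
  further = oneFurtherMissed b
  relabelled : ∀ c → missed c ≢ missed c₁ → τ (missed c) ≡ proj₁ further
  relabelled c m≢m₁ =
    CoversAllBut-missed (All.lookup (proj₂ further) (embeddings-complete (gT (T⁺ b)) g copy))
      τm∉ τm≢zero
    where
    copy : IsEmbedding (gT (T⁺ b)) g (τ ∘ embed c)
    copy = IsEmbedding-≋ (proj₂ extension)
             (IsEmbedding-pullback {h = h} {σ = σ} {τ} στ (isEmbedding c))
    τm∉ : τ (missed c) ∉ᵥ tabulate (τ ∘ embed c)
    τm∉ τm∈ with i , τm≡τfi ← tabulate⁻ {f = τ ∘ embed c} τm∈ =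
      misses c i (trans (sym (στ _)) (trans (cong σ (sym τm≡τfi)) (στ _)))
    τm≢zero : τ (missed c) ≢ zero
    τm≢zero τm≡zero = m≢m₁ (trans (sym (στ _)) (cong σ τm≡zero))

special : Special g
special h og []              _ _ = z≤n
special h og (_ ∷ [])        _ _ = s≤s z≤n
special h og (_ ∷ _ ∷ [])    _ _ = s≤s (s≤s z≤n)
special h og (_ ∷ _ ∷ _ ∷ _) ((A₁≢A₂ ∷ A₁≢A₃ ∷ _) ∷ (A₂≢A₃ ∷ _) ∷ _) (ri₁ ∷ ri₂ ∷ ri₃ ∷ _)
  with c₁ , A₁≡ ← restrictIso⇒copy ri₁ | c₂ , A₂≡ ← restrictIso⇒copy ri₂
     | c₃ , A₃≡ ← restrictIso⇒copy ri₃ =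
  ⊥-elim (A₂≢A₃ (same A₂≡ A₃≡ (copies-missSame og c₁ c₂ c₃ (λ e → A₁≢A₂ (same A₁≡ A₂≡ (sym e)))
                                                            (λ e → A₁≢A₃ (same A₁≡ A₃≡ (sym e))))))
  where
  same : ∀ {A A′ : Subset 7} {m m′} → A ≡ ∁ ⁅ m ⁆ → A′ ≡ ∁ ⁅ m′ ⁆ → m ≡ m′ → A ≡ A′
  same A≡ A′≡ refl = trans A≡ (sym A′≡)

autOrder : AutOrder g 5
autOrder = automorphisms , decided (unique? automorphisms) refl , refl ,
           λ v → aut⇒∈ v , All.lookup allAutomorphisms
  where
  automorphisms = embeddings g g
  allAutomorphisms : All (IsAut g ∘ lookup) automorphisms
  allAutomorphisms = decided (All.all? (isEmbedding? g g ∘ lookup) automorphisms) refl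
  aut⇒∈ : ∀ v → IsAut g (lookup v) → v ∈ₗ automorphisms
  aut⇒∈ v aut = subst (_∈ₗ automorphisms) (tabulate∘lookup v) (embeddings-complete g g aut)

lemma4p10 : Special g × AutOrder g 5
lemma4p10 = special , autOrder
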